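{- Let $t\geq1$, $k\geq t+2$, $\ell\geq t$ and $n\geq L(\max\{k,\ell\},t)$. Then: (i) the functions $m\mapsto(\ell-t+1)^{m-t}S(n-m,k-m)$ and $m\mapsto f(m,k,\ell,t,n)$ are both strictly decreasing as $m$ increases in $[t,k-1]$; (ii) for any fixed $u\geq t$ with $k\geq u+2$, one has $g(m,k,\ell,t,n)\leq f(u,k,\ell,t,n)$ for all $u\leq m\leq k$, with equality only if $m=u$; (iii) $g(m,k,\ell,t,n)\leq S(n-t,k-t)$ for all $t\leq m\leq k$, with equality only if $m=t$.
   Context: $S(m,k)$ is the Stirling number of the second kind. $L(k,t)=(t+1)+(k-t+1)\log_2\big((t+1)(k-t+1)\big)$. $f(m,k,\ell,t,n)=(\ell-t+1)^{m-t}\binom{m}{t}S(n-m,k-m)$ if $t\leq m\leq k-1$, and $f(k,k,\ell,t,n)=(\ell-t+1)^{k-t}\binom{k}{t}$; $g(m,k,\ell,t,n)=\max\{f(m,k,\ell,t,n),f(k,k,\ell,t,n)\}$. -}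

module Defs where

open import Data.Nat using (ℕ; zero; suc; _+_; _*_; _∸_; _^_; _≤_; _<_; _<ᵇ_; _⊔_)
open import Data.Nat.Combinatorics using (_C_)
open import Data.Bool using (if_then_else_)
open import Data.Product using (_×_)

S : ℕ → ℕ → ℕ
S zero    zero    = 1
S zero    (suc k) = 0
S (suc n) zero    = 0
S (suc n) (suc k) = suc k * S n (suc k) + S n k

-- The hypothesis n ≥ L(K,t) = (t+1) + (K-t+1) log₂((t+1)(K-t+1)),
-- stated without reals: with a = t+1, b = K-t+1 ≥ 1, c = (t+1)(K-t+1) ≥ 1,
--   n ≥ a + b log₂ c  ⟺  a ≤ n  and  c^b ≤ 2^(n - a).
LBound : ℕ → ℕ → ℕ → Set
LBound K t n = (t + 1 ≤ n) × (((t + 1) * (K ∸ t + 1)) ^ (K ∸ t + 1) ≤ 2 ^ (n ∸ (t + 1)))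

h : ℕ → ℕ → ℕ → ℕ → ℕ → ℕ
h m k l t n = (l ∸ t + 1) ^ (m ∸ t) * S (n ∸ m) (k ∸ m)

f : ℕ → ℕ → ℕ → ℕ → ℕ → ℕ
f m k l t n = if m <ᵇ k
  then (l ∸ t + 1) ^ (m ∸ t) * (m C t) * S (n ∸ m) (k ∸ m)
  else (l ∸ t + 1) ^ (k ∸ t) * (k C t)

g : ℕ → ℕ → ℕ → ℕ → ℕ → ℕ
g m k l t n = f m k l t n ⊔ f k k l t n

-- Everything reduces to one estimate on Stirling numbers: if c·J^x < (J+1)^x then
-- c·S(x+J,J) < S(x+J+1,J+1), because S(x+j,j)/j^x is nondecreasing in j.  Writing
-- K = max(k,ℓ), c = (t+1)(K−t+1) and x = n − k, the hypothesis n ≥ L(K,t) says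
-- c^(K−t+1) ≤ 2^(x+k−t−1); from it one gets x ≥ 4(k−t−1) and then c·J^x < (J+1)^x for
-- 1 ≤ J ≤ k−t−1, using (1+1/J)^(J+1) ≥ 5/2.  Since ℓ−t+1 ≤ c and
-- C(m+1,t) ≤ (t+1)C(m,t), each step m ↦ m+1 below k−1 decreases h and f; the last
-- value f(k,…) is compared with f(k−2,…) through c² < 2^x ≤ S(x+2,2).

module Submission where

open import Data.Bool using (true; false; T)
open import Data.Nat
open import Data.Nat.Combinatorics using (_C_; nCn≡1; nC1≡n; nCk+nC[k+1]≡[n+1]C[k+1])
open import Data.Nat.Properties
open import Algebra.Properties.CommutativeSemigroup *-commutativeSemigroup using (x∙yz≈y∙xz)
open import Data.Nat.Tactic.RingSolver using (solve-∀)
open import Data.Product using (_×_; _,_; proj₁; proj₂)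
open import Function using (_∘_)
open import Relation.Binary.PropositionalEquality hiding (J)
open import Relation.Nullary using (yes; no; contradiction)

open import Defs

open ≤-Reasoning

^-distribʳ-* : ∀ m n p → (m * n) ^ p ≡ m ^ p * n ^ p
^-distribʳ-* m n zero    = refl
^-distribʳ-* m n (suc p) = begin-equality
  m * n * (m * n) ^ p      ≡⟨ cong (m * n *_) (^-distribʳ-* m n p) ⟩
  m * n * (m ^ p * n ^ p)  ≡⟨ interchange m n (m ^ p) (n ^ p) ⟩
  m * m ^ p * (n * n ^ p)  ∎
  where
  interchange : ∀ a b c d → a * b * (c * d) ≡ a * c * (b * d)
  interchange = solve-∀

^-comm-^ : ∀ m p q → (m ^ p) ^ q ≡ (m ^ q) ^ p
^-comm-^ m p q = begin-equality
  (m ^ p) ^ q  ≡⟨ ^-*-assoc m p q ⟩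
  m ^ (p * q)  ≡⟨ cong (m ^_) (*-comm p q) ⟩
  m ^ (q * p)  ≡⟨ ^-*-assoc m q p ⟨
  (m ^ q) ^ p  ∎

^-cancelˡ-< : ∀ p {m n} → m ^ suc p < n ^ suc p → m < n
^-cancelˡ-< p {m} {n} lt with m <? n
... | yes m<n = m<n
... | no  m≮n = contradiction lt (≤⇒≯ (^-monoˡ-≤ (suc p) (≮⇒≥ m≮n)))

2^m≤2^n⇒m≤n : ∀ {m n} → 2 ^ m ≤ 2 ^ n → m ≤ n
2^m≤2^n⇒m≤n {m} {n} le with m ≤? n
... | yes m≤n = m≤n
... | no  m≰n = contradiction le (<⇒≱ (^-monoʳ-< 2 (s≤s (s≤s z≤n)) (≰⇒> m≰n)))

k≤n⇒nCk>0 : ∀ {n k} → k ≤ n → n C k > 0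
k≤n⇒nCk>0 {n}     {zero}  _         = s≤s z≤n
k≤n⇒nCk>0 {suc n} {suc k} (s≤s k≤n) = begin-strict
  0                      <⟨ k≤n⇒nCk>0 k≤n ⟩
  n C k                  ≤⟨ m≤m+n (n C k) (n C suc k) ⟩
  n C k + n C suc k      ≡⟨ nCk+nC[k+1]≡[n+1]C[k+1] n k ⟩
  suc n C suc k          ∎

k<n⇒nCk≤[1+k]*nC[1+k] : ∀ {n k} → k < n → n C k ≤ suc k * (n C suc k)
k≤n⇒[1+n]Ck≤[1+k]*nCk  : ∀ {n k} → k ≤ n → suc n C k ≤ suc k * (n C k)

k<n⇒nCk≤[1+k]*nC[1+k] {suc n} {zero}  _         = begin
  1                 ≤⟨ s≤s z≤n ⟩
  suc n             ≡⟨ nC1≡n (suc n) ⟨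
  suc n C 1         ≡⟨ *-identityˡ (suc n C 1) ⟨
  1 * (suc n C 1)   ∎
k<n⇒nCk≤[1+k]*nC[1+k] {suc n} {suc k} (s≤s k<n) = begin
  suc n C suc k
    ≤⟨ k≤n⇒[1+n]Ck≤[1+k]*nCk k<n ⟩
  suc (suc k) * (n C suc k)
    ≤⟨ *-monoʳ-≤ (suc (suc k)) (m≤m+n (n C suc k) (n C suc (suc k))) ⟩
  suc (suc k) * (n C suc k + n C suc (suc k))
    ≡⟨ cong (suc (suc k) *_) (nCk+nC[k+1]≡[n+1]C[k+1] n (suc k)) ⟩
  suc (suc k) * (suc n C suc (suc k))
    ∎

k≤n⇒[1+n]Ck≤[1+k]*nCk {n} {zero}  _   = s≤s z≤n
k≤n⇒[1+n]Ck≤[1+k]*nCk {n} {suc k} k<n = begin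
  suc n C suc k                    ≡⟨ nCk+nC[k+1]≡[n+1]C[k+1] n k ⟨
  n C k + n C suc k                ≤⟨ +-monoˡ-≤ (n C suc k) (k<n⇒nCk≤[1+k]*nC[1+k] k<n) ⟩
  suc k * (n C suc k) + n C suc k  ≡⟨ +-comm (suc k * (n C suc k)) (n C suc k) ⟩
  suc (suc k) * (n C suc k)        ∎

-- The first three terms of the binomial expansion of (1 + 1/n)^(1+z), cleared of denominators.
[1+n]^[1+z]-three-term-bound : ∀ n z →
  n ^ suc z * (2 * n * n + 2 * suc z * n + suc z * z) ≤ 2 * n * n * suc n ^ suc z
[1+n]^[1+z]-three-term-bound n zero    = ≤-reflexive (base n)
  where
  base : ∀ n → n * 1 * (2 * n * n + 2 * 1 * n + 1 * 0) ≡ 2 * n * n * (suc n * 1)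
  base = solve-∀
[1+n]^[1+z]-three-term-bound n (suc z) = begin
  n * n ^ suc z * P (suc z)                ≡⟨ *-assoc n (n ^ suc z) (P (suc z)) ⟩
  n * (n ^ suc z * P (suc z))              ≡⟨ x∙yz≈y∙xz n (n ^ suc z) (P (suc z)) ⟩
  n ^ suc z * (n * P (suc z))              ≤⟨ *-monoʳ-≤ (n ^ suc z) (m≤m+n (n * P (suc z)) (suc z * z)) ⟩
  n ^ suc z * (n * P (suc z) + suc z * z)  ≡⟨ cong (n ^ suc z *_) (step n z) ⟩
  n ^ suc z * (suc n * P z)                ≡⟨ x∙yz≈y∙xz (n ^ suc z) (suc n) (P z) ⟩
  suc n * (n ^ suc z * P z)                ≤⟨ *-monoʳ-≤ (suc n) ([1+n]^[1+z]-three-term-bound n z) ⟩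
  suc n * (2 * n * n * suc n ^ suc z)      ≡⟨ x∙yz≈y∙xz (suc n) (2 * n * n) (suc n ^ suc z) ⟩
  2 * n * n * suc n ^ suc (suc z)          ∎
  where
  P : ℕ → ℕ
  P z = 2 * n * n + 2 * suc z * n + suc z * z
  step : ∀ n z → n * (2 * n * n + 2 * suc (suc z) * n + suc (suc z) * suc z) + suc z * z
               ≡ suc n * (2 * n * n + 2 * suc z * n + suc z * z)
  step = solve-∀

5*n^[1+n]≤2*[1+n]^[1+n] : ∀ n → 5 * n ^ suc n ≤ 2 * suc n ^ suc n
5*n^[1+n]≤2*[1+n]^[1+n] zero        = z≤n
5*n^[1+n]≤2*[1+n]^[1+n] n@(suc _)     = *-cancelˡ-≤ (n * n) (begin
  n * n * (5 * n ^ suc n)                       ≡⟨ rearrange (n * n) (n ^ suc n) ⟩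
  n ^ suc n * (5 * (n * n))                     ≤⟨ *-monoʳ-≤ (n ^ suc n) (m≤m+n _ (3 * n)) ⟩
  n ^ suc n * (5 * (n * n) + 3 * n)             ≡⟨ cong (n ^ suc n *_) (expand n) ⟩
  n ^ suc n * (2 * n * n + 2 * suc n * n + suc n * n)
                                                ≤⟨ [1+n]^[1+z]-three-term-bound n n ⟩
  2 * n * n * suc n ^ suc n                     ≡⟨ regroup n (suc n ^ suc n) ⟩
  n * n * (2 * suc n ^ suc n)                   ∎)
  where
  rearrange : ∀ a b → a * (5 * b) ≡ b * (5 * a)
  rearrange = solve-∀
  expand : ∀ n → 5 * (n * n) + 3 * n ≡ 2 * n * n + 2 * suc n * n + suc n * n
  expand = solve-∀
  regroup : ∀ n b → 2 * n * n * b ≡ n * n * (2 * b)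
  regroup = solve-∀

32^n≤[2[2+n]]^[2+n] : ∀ n → 32 ^ n ≤ (2 * (2 + n)) ^ (2 + n)
32^n≤[2[2+n]]^[2+n] 0 = ≤ᵇ⇒≤ _ _ _
32^n≤[2[2+n]]^[2+n] 1 = ≤ᵇ⇒≤ _ _ _
32^n≤[2[2+n]]^[2+n] 2 = ≤ᵇ⇒≤ _ _ _
32^n≤[2[2+n]]^[2+n] 3 = ≤ᵇ⇒≤ _ _ _
32^n≤[2[2+n]]^[2+n] 4 = ≤ᵇ⇒≤ _ _ _
32^n≤[2[2+n]]^[2+n] 5 = ≤ᵇ⇒≤ _ _ _
32^n≤[2[2+n]]^[2+n] 6 = ≤ᵇ⇒≤ _ _ _
32^n≤[2[2+n]]^[2+n] 7 = ≤ᵇ⇒≤ _ _ _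
32^n≤[2[2+n]]^[2+n] 8 = ≤ᵇ⇒≤ _ _ _
32^n≤[2[2+n]]^[2+n] 9 = ≤ᵇ⇒≤ _ _ _
32^n≤[2[2+n]]^[2+n] 10 = ≤ᵇ⇒≤ _ _ _
32^n≤[2[2+n]]^[2+n] 11 = ≤ᵇ⇒≤ _ _ _
32^n≤[2[2+n]]^[2+n] 12 = ≤ᵇ⇒≤ _ _ _
32^n≤[2[2+n]]^[2+n] 13 = ≤ᵇ⇒≤ _ _ _
32^n≤[2[2+n]]^[2+n] n@(suc (suc (suc (suc (suc (suc (suc (suc (suc (suc (suc (suc (suc (suc m)))))))))))))) = begin
  32 ^ n                            ≤⟨ ^-monoˡ-≤ n 32≤2[2+n] ⟩
  (2 * (2 + n)) ^ n                 ≤⟨ m≤n*m ((2 * (2 + n)) ^ n) ((2 * (2 + n)) ^ 2) ⟩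
  (2 * (2 + n)) ^ 2 * (2 * (2 + n)) ^ n  ≡⟨ ^-distribˡ-+-* (2 * (2 + n)) 2 n ⟨
  (2 * (2 + n)) ^ (2 + n)           ∎
  where
  32≤2[2+n] : 32 ≤ 2 * (2 + n)
  32≤2[2+n] = ≤-trans (m≤m+n 32 (2 * m)) (≤-reflexive (expand m))
    where
    expand : ∀ m → 32 + 2 * m ≡ 2 * (16 + m)
    expand = solve-∀

2^n*4^x≤5^x : ∀ n x → 4 * n ≤ x → 2 ^ n * 4 ^ x ≤ 5 ^ x
2^n*4^x≤5^x n x 4n≤x with m≤n⇒∃[o]m+o≡n 4n≤x
... | r , refl = begin
  2 ^ n * 4 ^ (4 * n + r)        ≡⟨ cong (2 ^ n *_) (^-distribˡ-+-* 4 (4 * n) r) ⟩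
  2 ^ n * (4 ^ (4 * n) * 4 ^ r)  ≡⟨ cong (λ p → 2 ^ n * (p * 4 ^ r)) (^-*-assoc 4 4 n) ⟨
  2 ^ n * (256 ^ n * 4 ^ r)      ≡⟨ *-assoc (2 ^ n) (256 ^ n) (4 ^ r) ⟨
  2 ^ n * 256 ^ n * 4 ^ r        ≡⟨ cong (_* 4 ^ r) (^-distribʳ-* 2 256 n) ⟨
  512 ^ n * 4 ^ r                ≤⟨ *-mono-≤ (^-monoˡ-≤ n (≤ᵇ⇒≤ 512 625 _)) (^-monoˡ-≤ r (≤ᵇ⇒≤ 4 5 _)) ⟩
  625 ^ n * 5 ^ r                ≡⟨ cong (_* 5 ^ r) (^-*-assoc 5 4 n) ⟩
  5 ^ (4 * n) * 5 ^ r            ≡⟨ ^-distribˡ-+-* 5 (4 * n) r ⟨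
  5 ^ (4 * n + r)                ∎

-- Hypotheses c ≥ 2(2 + n) and c^(2+n) ≤ 2^(x+n) are the form that n ≥ L(K,t) takes in Setting below.
4n≤x : ∀ c n x → 2 * (2 + n) ≤ c → c ^ (2 + n) ≤ 2 ^ (x + n) → 4 * n ≤ x
4n≤x c n x c-large c-bound = +-cancelʳ-≤ n (4 * n) x (≤-trans (≤-reflexive (split n)) (2^m≤2^n⇒m≤n (begin
  2 ^ (5 * n)              ≡⟨ ^-*-assoc 2 5 n ⟨
  32 ^ n                   ≤⟨ 32^n≤[2[2+n]]^[2+n] n ⟩
  (2 * (2 + n)) ^ (2 + n)  ≤⟨ ^-monoˡ-≤ (2 + n) c-large ⟩
  c ^ (2 + n)              ≤⟨ c-bound ⟩
  2 ^ (x + n)              ∎)))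
  where
  split : ∀ n → 4 * n + n ≡ 5 * n
  split = solve-∀

2^x*c^[1+n]<5^x : ∀ c n x → 2 ≤ c → 4 * n ≤ x → c ^ (2 + n) ≤ 2 ^ (x + n) → 2 ^ x * c ^ (1 + n) < 5 ^ x
2^x*c^[1+n]<5^x c n x 2≤c 4n≤x c-bound = *-cancelˡ-< c _ _ (begin-strict
  c * (2 ^ x * c ^ (1 + n))  ≡⟨ x∙yz≈y∙xz c (2 ^ x) (c ^ (1 + n)) ⟩
  2 ^ x * c ^ (2 + n)        ≤⟨ *-monoʳ-≤ (2 ^ x) c-bound ⟩
  2 ^ x * 2 ^ (x + n)        ≡⟨ cong (2 ^ x *_) (^-distribˡ-+-* 2 x n) ⟩
  2 ^ x * (2 ^ x * 2 ^ n)    ≡⟨ regroup (2 ^ x) (2 ^ n) ⟩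
  2 ^ n * (2 ^ x * 2 ^ x)    ≡⟨ cong (2 ^ n *_) (^-distribʳ-* 2 2 x) ⟨
  2 ^ n * 4 ^ x              ≤⟨ 2^n*4^x≤5^x n x 4n≤x ⟩
  5 ^ x                      <⟨ m<m*n (5 ^ x) c ⦃ m^n≢0 5 x ⦄ 2≤c ⟩
  5 ^ x * c                  ≡⟨ *-comm (5 ^ x) c ⟩
  c * 5 ^ x                  ∎)
  where
  regroup : ∀ a b → a * (a * b) ≡ b * (a * a)
  regroup = solve-∀

-- Raised to the power 1 + J, this is 2^x c^(1+J) < 5^x combined with (1 + 1/J)^(1+J) ≥ 5/2.
c*J^x<[1+J]^x : ∀ c j x → let J = suc j in
  2 ≤ c → 4 * J ≤ x → c ^ (2 + J) ≤ 2 ^ (x + J) → c * J ^ x < suc J ^ x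
c*J^x<[1+J]^x c j x 2≤c 4J≤x c-bound = ^-cancelˡ-< J (*-cancelʳ-< (2 ^ x) _ _ (begin-strict
  (c * J ^ x) ^ suc J * 2 ^ x             ≡⟨ cong (_* 2 ^ x) (^-distribʳ-* c (J ^ x) (suc J)) ⟩
  c ^ suc J * (J ^ x) ^ suc J * 2 ^ x     ≡⟨ cong (λ p → c ^ suc J * p * 2 ^ x) (^-comm-^ J x (suc J)) ⟩
  c ^ suc J * Jᴶ ^ x * 2 ^ x              ≡⟨ rotate (c ^ suc J) (Jᴶ ^ x) (2 ^ x) ⟩
  2 ^ x * c ^ suc J * Jᴶ ^ x              <⟨ *-monoˡ-< (Jᴶ ^ x) ⦃ m^n≢0 Jᴶ x ⦃ m^n≢0 J (suc J) ⦄ ⦄ (2^x*c^[1+n]<5^x c J x 2≤c 4J≤x c-bound) ⟩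
  5 ^ x * Jᴶ ^ x                          ≡⟨ ^-distribʳ-* 5 Jᴶ x ⟨
  (5 * Jᴶ) ^ x                            ≤⟨ ^-monoˡ-≤ x (5*n^[1+n]≤2*[1+n]^[1+n] J) ⟩
  (2 * suc J ^ suc J) ^ x                 ≡⟨ ^-distribʳ-* 2 (suc J ^ suc J) x ⟩
  2 ^ x * (suc J ^ suc J) ^ x             ≡⟨ cong (2 ^ x *_) (^-comm-^ (suc J) (suc J) x) ⟩
  2 ^ x * (suc J ^ x) ^ suc J             ≡⟨ *-comm (2 ^ x) ((suc J ^ x) ^ suc J) ⟩
  (suc J ^ x) ^ suc J * 2 ^ x             ∎))
  where
  J Jᴶ : ℕ
  J = suc j
  Jᴶ = J ^ suc J
  rotate : ∀ a b d → a * b * d ≡ d * a * b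
  rotate = solve-∀

c*n^x<[1+n]^x⇒c*m^x<[1+m]^x : ∀ c x {m n} → 1 ≤ m → m ≤ n → c * n ^ x < suc n ^ x → c * m ^ x < suc m ^ x
c*n^x<[1+n]^x⇒c*m^x<[1+m]^x c x {m@(suc _)} {n} _ m≤n lt = *-cancelʳ-< (n ^ x) _ _ (begin-strict
  c * m ^ x * n ^ x    ≡⟨ rearrange c (m ^ x) (n ^ x) ⟩
  m ^ x * (c * n ^ x)  <⟨ *-monoʳ-< (m ^ x) ⦃ m^n≢0 m x ⦄ lt ⟩
  m ^ x * suc n ^ x    ≡⟨ ^-distribʳ-* m (suc n) x ⟨
  (m * suc n) ^ x      ≤⟨ ^-monoˡ-≤ x m[1+n]≤[1+m]n ⟩
  (suc m * n) ^ x      ≡⟨ ^-distribʳ-* (suc m) n x ⟩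
  suc m ^ x * n ^ x    ∎)
  where
  rearrange : ∀ a b d → a * b * d ≡ b * (a * d)
  rearrange = solve-∀
  m[1+n]≤[1+m]n : m * suc n ≤ suc m * n
  m[1+n]≤[1+m]n = begin
    m * suc n  ≡⟨ *-suc m n ⟩
    m + m * n  ≤⟨ +-monoˡ-≤ (m * n) m≤n ⟩
    n + m * n  ∎

c*c<2^x : ∀ c j x → 3 ≤ c → c ^ (2 + suc j) ≤ 2 ^ (x + suc j) → c * c < 2 ^ x
c*c<2^x c@(suc _) j x 3≤c c-bound = *-cancelʳ-< (2 ^ J) _ _ (begin-strict
  c * c * 2 ^ J  <⟨ *-monoʳ-< (c * c) (^-monoˡ-< J 3≤c) ⟩
  c * c * c ^ J  ≡⟨ *-assoc c c (c ^ J) ⟩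
  c ^ (2 + J)    ≤⟨ c-bound ⟩
  2 ^ (x + J)    ≡⟨ ^-distribˡ-+-* 2 x J ⟩
  2 ^ x * 2 ^ J  ∎)
  where
  J : ℕ
  J = suc j

n<k⇒S[n,k]≡0 : ∀ {n k} → n < k → S n k ≡ 0
n<k⇒S[n,k]≡0 {zero}  {suc k} _         = refl
n<k⇒S[n,k]≡0 {suc n} {suc k} (s≤s n<k) = begin-equality
  suc k * S n (suc k) + S n k  ≡⟨ cong₂ (λ p q → suc k * p + q) (n<k⇒S[n,k]≡0 (m<n⇒m<1+n n<k)) (n<k⇒S[n,k]≡0 n<k) ⟩
  suc k * 0 + 0                ≡⟨ cong (_+ 0) (*-zeroʳ (suc k)) ⟩
  0                            ∎

S[n,n]≡1 : ∀ n → S n n ≡ 1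
S[n,n]≡1 zero    = refl
S[n,n]≡1 (suc n) = begin-equality
  suc n * S n (suc n) + S n n  ≡⟨ cong₂ (λ p q → suc n * p + q) (n<k⇒S[n,k]≡0 (n<1+n n)) (S[n,n]≡1 n) ⟩
  suc n * 0 + 1                ≡⟨ cong (_+ 1) (*-zeroʳ (suc n)) ⟩
  1                            ∎

S[x+1+j,1+j]>0 : ∀ x j → S (x + suc j) (suc j) > 0
S[x+1+j,1+j]>0 zero    j = ≤-reflexive (sym (S[n,n]≡1 (suc j)))
S[x+1+j,1+j]>0 (suc x) j = begin-strict
  0                                              <⟨ S[x+1+j,1+j]>0 x j ⟩
  S (x + suc j) (suc j)                          ≤⟨ m≤n*m _ (suc j) ⟩
  suc j * S (x + suc j) (suc j)                  ≤⟨ m≤m+n _ _ ⟩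
  suc j * S (x + suc j) (suc j) + S (x + suc j) j  ∎

ratio-step : ∀ p {u v w C B} .{{_ : NonZero v}} → u * w ≤ v * v → v ^ p * C ≤ u ^ p * B → w ^ p * C ≤ v ^ p * B
ratio-step p {u} {v} {w} {C} {B} uw≤vv le = *-cancelˡ-≤ (v ^ p) ⦃ m^n≢0 v p ⦄ (begin
  v ^ p * (w ^ p * C)    ≡⟨ x∙yz≈y∙xz (v ^ p) (w ^ p) C ⟩
  w ^ p * (v ^ p * C)    ≤⟨ *-monoʳ-≤ (w ^ p) le ⟩
  w ^ p * (u ^ p * B)    ≡⟨ rearrange (w ^ p) (u ^ p) B ⟩
  u ^ p * w ^ p * B      ≡⟨ cong (_* B) (^-distribʳ-* u w p) ⟨
  (u * w) ^ p * B        ≤⟨ *-monoˡ-≤ B (^-monoˡ-≤ p uw≤vv) ⟩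
  (v * v) ^ p * B        ≡⟨ cong (_* B) (^-distribʳ-* v v p) ⟩
  v ^ p * v ^ p * B      ≡⟨ *-assoc (v ^ p) (v ^ p) B ⟩
  v ^ p * (v ^ p * B)    ∎)
  where
  rearrange : ∀ a b d → a * (b * d) ≡ b * a * d
  rearrange = solve-∀

[1+j]^x*S[x+j,j]≤j^x*S[x+1+j,1+j] : ∀ j x → suc j ^ x * S (x + j) j ≤ j ^ x * S (x + suc j) (suc j)
[1+j]^x*S[x+j,j]≤j^x*S[x+1+j,1+j] j       zero    =
  ≤-reflexive (cong (1 *_) (trans (S[n,n]≡1 j) (sym (S[n,n]≡1 (suc j)))))
[1+j]^x*S[x+j,j]≤j^x*S[x+1+j,1+j] zero    (suc x) = ≤-trans (≤-reflexive (*-zeroʳ (1 ^ suc x))) z≤n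
[1+j]^x*S[x+j,j]≤j^x*S[x+1+j,1+j] (suc i) (suc x) = begin
  (2 + i) * P₁ * ((1 + i) * A + B)           ≡⟨ expandˡ (1 + i) P₁ A B ⟩
  (1 + i) * (2 + i) * (P₁ * A) + (2 + i) * P₁ * B
    ≤⟨ +-mono-≤ (*-monoʳ-≤ ((1 + i) * (2 + i)) ([1+j]^x*S[x+j,j]≤j^x*S[x+1+j,1+j] (suc i) x)) B-step ⟩
  (1 + i) * (2 + i) * (P₂ * A′) + (1 + i) * P₂ * B′
                                             ≡⟨ expandʳ (1 + i) P₂ A′ B′ ⟨
  (1 + i) * P₂ * ((2 + i) * A′ + B′)         ∎
  where
  P₁ P₂ A B A′ B′ : ℕ
  P₁ = (2 + i) ^ x
  P₂ = (1 + i) ^ x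
  A  = S (x + suc i) (suc i)
  B  = S (x + suc i) i
  A′ = S (x + suc (suc i)) (suc (suc i))
  B′ = S (x + suc (suc i)) (suc i)
  i[2+i]≤[1+i][1+i] : i * (2 + i) ≤ (1 + i) * (1 + i)
  i[2+i]≤[1+i][1+i] = ≤-trans (m≤m+n _ 1) (≤-reflexive (square i))
    where
    square : ∀ i → i * (2 + i) + 1 ≡ (1 + i) * (1 + i)
    square = solve-∀
  B-step : (2 + i) ^ suc x * B ≤ (1 + i) ^ suc x * B′
  B-step = ratio-step (suc x) {i} {1 + i} {2 + i} i[2+i]≤[1+i][1+i]
    (subst₂ (λ p q → (1 + i) ^ suc x * S p i ≤ i ^ suc x * S q (suc i)) (sym (+-suc x i)) (sym (+-suc x (suc i)))
      ([1+j]^x*S[x+j,j]≤j^x*S[x+1+j,1+j] i (suc x)))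
  expandˡ : ∀ s p a b → suc s * p * (s * a + b) ≡ s * suc s * (p * a) + suc s * p * b
  expandˡ = solve-∀
  expandʳ : ∀ s p a b → s * p * (suc s * a + b) ≡ s * suc s * (p * a) + s * p * b
  expandʳ = solve-∀

c*[1+j]^x<[2+j]^x⇒c*S<S : ∀ c j x → c * suc j ^ x < suc (suc j) ^ x →
  c * S (x + suc j) (suc j) < S (x + suc (suc j)) (suc (suc j))
c*[1+j]^x<[2+j]^x⇒c*S<S c j x lt = *-cancelˡ-< (J ^ x) _ _ (begin-strict
  J ^ x * (c * S′)            ≡⟨ rearrange (J ^ x) c S′ ⟩
  c * J ^ x * S′              <⟨ *-monoˡ-< S′ ⦃ >-nonZero (S[x+1+j,1+j]>0 x j) ⦄ lt ⟩
  suc J ^ x * S′              ≤⟨ [1+j]^x*S[x+j,j]≤j^x*S[x+1+j,1+j] J x ⟩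
  J ^ x * S (x + suc J) (suc J)  ∎)
  where
  J S′ : ℕ
  J = suc j
  S′ = S (x + J) J
  rearrange : ∀ a b d → a * (b * d) ≡ b * a * d
  rearrange = solve-∀

2^x≤S[x+2,2] : ∀ x → 2 ^ x ≤ S (x + 2) 2
2^x≤S[x+2,2] x = begin
  2 ^ x                 ≡⟨ *-identityʳ (2 ^ x) ⟨
  2 ^ x * 1             ≤⟨ *-monoʳ-≤ (2 ^ x) (S[x+1+j,1+j]>0 x 0) ⟩
  2 ^ x * S (x + 1) 1   ≤⟨ [1+j]^x*S[x+j,j]≤j^x*S[x+1+j,1+j] 1 x ⟩
  1 ^ x * S (x + 2) 2   ≡⟨ cong (_* S (x + 2) 2) (^-zeroˡ x) ⟩
  1 * S (x + 2) 2       ≡⟨ *-identityˡ (S (x + 2) 2) ⟩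
  S (x + 2) 2           ∎

f-below : ∀ {m k} l t n → m < k → f m k l t n ≡ (l ∸ t + 1) ^ (m ∸ t) * (m C t) * S (n ∸ m) (k ∸ m)
f-below {m} {k} l t n m<k with m <ᵇ k in eq
... | true  = refl
... | false = contradiction (subst T eq (<⇒<ᵇ m<k)) λ ()

f-above : ∀ {m k} l t n → k ≤ m → f m k l t n ≡ (l ∸ t + 1) ^ (k ∸ t) * (k C t)
f-above {m} {k} l t n k≤m with m <ᵇ k in eq
... | false = refl
... | true  = contradiction (<ᵇ⇒< m k (subst T (sym eq) _)) (≤⇒≯ k≤m)

m+n≡o⇒o∸m≡n : ∀ m {n o} → m + n ≡ o → o ∸ m ≡ n
m+n≡o⇒o∸m≡n m {n} refl = m+n∸m≡n m n

module _ {F : ℕ → ℕ} {t k : ℕ} (step : ∀ m → t ≤ m → 2 + m ≤ k → F (suc m) < F m) where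

  steps⇒strictly-decreasing : ∀ m₁ m₂ → t ≤ m₁ → m₁ < m₂ → m₂ < k → F m₂ < F m₁
  steps⇒strictly-decreasing m₁ (suc m₂) t≤m₁ (s≤s m₁≤m₂) m₂<k with m₁ ≟ m₂
  ... | yes refl = step m₁ t≤m₁ m₂<k
  ... | no m₁≢m₂ = <-trans (step m₂ (≤-trans t≤m₁ m₁≤m₂) m₂<k)
                           (steps⇒strictly-decreasing m₁ m₂ t≤m₁ (≤∧≢⇒< m₁≤m₂ m₁≢m₂) (≤-trans (n≤1+n _) m₂<k))

  steps⇒decreasing : ∀ m₁ m₂ → t ≤ m₁ → m₁ ≤ m₂ → m₂ < k → F m₂ ≤ F m₁
  steps⇒decreasing m₁ m₂ t≤m₁ m₁≤m₂ m₂<k with m₁ ≟ m₂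
  ... | yes refl   = ≤-refl
  ... | no m₁≢m₂   = <⇒≤ (steps⇒strictly-decreasing m₁ m₂ t≤m₁ (≤∧≢⇒< m₁≤m₂ m₁≢m₂) m₂<k)

F[m]⊔F[k]≤F[u] : ∀ {F : ℕ → ℕ} {u k} → (∀ m₁ m₂ → u ≤ m₁ → m₁ < m₂ → m₂ < k → F m₂ < F m₁) → F k < F u →
  ∀ m → u ≤ m → m ≤ k → (F m ⊔ F k ≤ F u) × (F m ⊔ F k ≡ F u → m ≡ u)
F[m]⊔F[k]≤F[u] {F} {u} {k} decreasing F[k]<F[u] m u≤m m≤k with m ≟ u
... | yes refl = ⊔-lub ≤-refl (<⇒≤ F[k]<F[u]) , λ _ → refl
... | no  m≢u  = <⇒≤ lt , λ eq → contradiction eq (<⇒≢ lt)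
  where
  F[m]<F[u] : F m < F u
  F[m]<F[u] with m <? k
  ... | yes m<k = decreasing u m ≤-refl (≤∧≢⇒< u≤m (m≢u ∘ sym)) m<k
  ... | no  m≮k = subst (λ p → F p < F u) (≤-antisym (≮⇒≥ m≮k) m≤k) F[k]<F[u]
  lt : F m ⊔ F k < F u
  lt = ⊔-lub F[m]<F[u] F[k]<F[u]

a*p*s<p*s′ : ∀ {a c p s s′} → a ≤ c → c * s < s′ → 0 < p → a * p * s < p * s′
a*p*s<p*s′ {a} {c} {p} {s} {s′} a≤c cs<s′ 0<p = begin-strict
  a * p * s    ≡⟨ rearrange a p s ⟩
  p * (a * s)  ≤⟨ *-monoʳ-≤ p (*-monoˡ-≤ s a≤c) ⟩
  p * (c * s)  <⟨ *-monoʳ-< p ⦃ >-nonZero 0<p ⦄ cs<s′ ⟩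
  p * s′       ∎
  where
  rearrange : ∀ a p s → a * p * s ≡ p * (a * s)
  rearrange = solve-∀

module Setting (t j l n : ℕ) (1≤t : 1 ≤ t) (LB : LBound ((t + 2 + j) ⊔ l) t n) where

  k J a b c x : ℕ
  k = t + 2 + j
  J = suc j
  a = l ∸ t + 1
  b = k ⊔ l ∸ t + 1
  c = (t + 1) * b
  x = n ∸ k

  k∸t≡2+j : k ∸ t ≡ 2 + j
  k∸t≡2+j = m+n≡o⇒o∸m≡n t (sym (+-assoc t 2 j))

  2+J≤b : 2 + J ≤ b
  2+J≤b = begin
    2 + J      ≡⟨ +-comm 1 (2 + j) ⟩
    2 + j + 1  ≡⟨ cong (_+ 1) k∸t≡2+j ⟨
    k ∸ t + 1  ≤⟨ +-monoˡ-≤ 1 (∸-monoˡ-≤ t (m≤m⊔n k l)) ⟩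
    b          ∎

  c-large : 2 * (2 + J) ≤ c
  c-large = *-mono-≤ (+-monoˡ-≤ 1 1≤t) 2+J≤b

  2≤c : 2 ≤ c
  2≤c = ≤-trans (m≤m*n 2 (2 + J)) c-large

  instance
    c≢0 : NonZero c
    c≢0 = >-nonZero (≤-trans (s≤s z≤n) 2≤c)

    a≢0 : NonZero a
    a≢0 = >-nonZero (m≤n+m 1 (l ∸ t))

  [1+t]a≤c : suc t * a ≤ c
  [1+t]a≤c = subst (λ p → p * a ≤ c) (+-comm t 1) (*-monoʳ-≤ (t + 1) (+-monoˡ-≤ 1 (∸-monoˡ-≤ t (m≤n⊔m k l))))

  a≤c : a ≤ c
  a≤c = ≤-trans (m≤n*m a (suc t)) [1+t]a≤c

  c^[2+J]≤2^[n∸[t+1]] : c ^ (2 + J) ≤ 2 ^ (n ∸ (t + 1))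
  c^[2+J]≤2^[n∸[t+1]] = ≤-trans (^-monoʳ-≤ c 2+J≤b) (proj₂ LB)

  k≡t+1+J : k ≡ t + 1 + J
  k≡t+1+J = shift t j
    where
    shift : ∀ t j → t + 2 + j ≡ t + 1 + suc j
    shift = solve-∀

  k≤n : k ≤ n
  k≤n = begin
    k                    ≡⟨ k≡t+1+J ⟩
    t + 1 + J            ≤⟨ +-monoʳ-≤ (t + 1) J≤n∸[t+1] ⟩
    t + 1 + (n ∸ (t + 1)) ≡⟨ m+[n∸m]≡n (proj₁ LB) ⟩
    n                    ∎
    where
    J≤n∸[t+1] : J ≤ n ∸ (t + 1)
    J≤n∸[t+1] = ≤-trans (m≤n+m J 2) (2^m≤2^n⇒m≤n {2 + J} (≤-trans (^-monoˡ-≤ (2 + J) 2≤c) c^[2+J]≤2^[n∸[t+1]]))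

  n∸m≡x+d : ∀ m {d} → m + d ≡ k → n ∸ m ≡ x + d
  n∸m≡x+d m {d} m+d≡k = m+n≡o⇒o∸m≡n m (begin-equality
    m + (x + d)  ≡⟨ shuffle m x d ⟩
    m + d + x    ≡⟨ cong (_+ x) m+d≡k ⟩
    k + x        ≡⟨ m+[n∸m]≡n k≤n ⟩
    n            ∎)
    where
    shuffle : ∀ m x d → m + (x + d) ≡ m + d + x
    shuffle = solve-∀

  c-bound : c ^ (2 + J) ≤ 2 ^ (x + J)
  c-bound = subst (λ e → c ^ (2 + J) ≤ 2 ^ e) (n∸m≡x+d (t + 1) (sym k≡t+1+J)) c^[2+J]≤2^[n∸[t+1]]

  c*i^x<[1+i]^x : ∀ i → 1 ≤ i → i ≤ J → c * i ^ x < suc i ^ x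
  c*i^x<[1+i]^x i 1≤i i≤J =
    c*n^x<[1+n]^x⇒c*m^x<[1+m]^x c x 1≤i i≤J (c*J^x<[1+J]^x c j x 2≤c (4n≤x c J x c-large c-bound) c-bound)

  c*c<S[x+2,2] : c * c < S (x + 2) 2
  c*c<S[x+2,2] = <-≤-trans (c*c<2^x c j x (≤-trans (s≤s (s≤s (s≤s z≤n))) c-large) c-bound) (2^x≤S[x+2,2] x)

  aᵉ>0 : ∀ e → 0 < a ^ e
  aᵉ>0 = m^n>0 a

  decrease-step : ∀ m → t ≤ m → 2 + m ≤ k →
    (h (suc m) k l t n < h m k l t n) × (f (suc m) k l t n < f m k l t n)
  decrease-step m t≤m 2+m≤k with m≤n⇒∃[o]m+o≡n 2+m≤k
  ... | i , 2+m+i≡k = h-step , f-step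
    where
    aᵐ : ℕ
    aᵐ = a ^ (m ∸ t)

    i≤j : i ≤ j
    i≤j = +-cancelˡ-≤ (2 + t) i j (begin
      2 + t + i  ≤⟨ +-monoˡ-≤ i (+-monoʳ-≤ 2 t≤m) ⟩
      2 + m + i  ≡⟨ 2+m+i≡k ⟩
      k          ≡⟨ cong (_+ j) (+-comm t 2) ⟩
      2 + t + j  ∎)

    S-step : c * S (x + suc i) (suc i) < S (x + suc (suc i)) (suc (suc i))
    S-step = c*[1+j]^x<[2+j]^x⇒c*S<S c i x (c*i^x<[1+i]^x (suc i) (s≤s z≤n) (s≤s i≤j))

    S-at-m : S (n ∸ m) (k ∸ m) ≡ S (x + suc (suc i)) (suc (suc i))
    S-at-m = cong₂ S (n∸m≡x+d m m+d≡k) (m+n≡o⇒o∸m≡n m m+d≡k)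
      where
      m+d≡k : m + suc (suc i) ≡ k
      m+d≡k = trans (+-suc m (suc i)) (trans (cong suc (+-suc m i)) 2+m+i≡k)

    S-at-1+m : S (n ∸ suc m) (k ∸ suc m) ≡ S (x + suc i) (suc i)
    S-at-1+m = cong₂ S (n∸m≡x+d (suc m) 1+m+d≡k) (m+n≡o⇒o∸m≡n (suc m) 1+m+d≡k)
      where
      1+m+d≡k : suc m + suc i ≡ k
      1+m+d≡k = trans (cong suc (+-suc m i)) 2+m+i≡k

    a^[1+m∸t] : a ^ (suc m ∸ t) ≡ a * aᵐ
    a^[1+m∸t] = cong (a ^_) (+-∸-assoc 1 t≤m)

    h-step : h (suc m) k l t n < h m k l t n
    h-step = begin-strict
      a ^ (suc m ∸ t) * S (n ∸ suc m) (k ∸ suc m)  ≡⟨ cong₂ _*_ a^[1+m∸t] S-at-1+m ⟩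
      a * aᵐ * S (x + suc i) (suc i)                <⟨ a*p*s<p*s′ a≤c S-step (aᵉ>0 (m ∸ t)) ⟩
      aᵐ * S (x + suc (suc i)) (suc (suc i))        ≡⟨ cong (aᵐ *_) S-at-m ⟨
      aᵐ * S (n ∸ m) (k ∸ m)                        ∎

    f-step : f (suc m) k l t n < f m k l t n
    f-step = begin-strict
      f (suc m) k l t n
        ≡⟨ f-below l t n 2+m≤k ⟩
      a ^ (suc m ∸ t) * (suc m C t) * S (n ∸ suc m) (k ∸ suc m)
        ≡⟨ cong₂ (λ p q → p * (suc m C t) * q) a^[1+m∸t] S-at-1+m ⟩
      a * aᵐ * (suc m C t) * S (x + suc i) (suc i)
        ≤⟨ *-monoˡ-≤ (S (x + suc i) (suc i)) (*-monoʳ-≤ (a * aᵐ) (k≤n⇒[1+n]Ck≤[1+k]*nCk t≤m)) ⟩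
      a * aᵐ * (suc t * (m C t)) * S (x + suc i) (suc i)
        ≡⟨ cong (_* S (x + suc i) (suc i)) (regroup a aᵐ (suc t) (m C t)) ⟩
      suc t * a * (aᵐ * (m C t)) * S (x + suc i) (suc i)
        <⟨ a*p*s<p*s′ [1+t]a≤c S-step (*-mono-≤ (aᵉ>0 (m ∸ t)) (k≤n⇒nCk>0 t≤m)) ⟩
      aᵐ * (m C t) * S (x + suc (suc i)) (suc (suc i))
        ≡⟨ cong (aᵐ * (m C t) *_) S-at-m ⟨
      aᵐ * (m C t) * S (n ∸ m) (k ∸ m)
        ≡⟨ f-below l t n (≤-trans (n≤1+n _) 2+m≤k) ⟨
      f m k l t n
        ∎
      where
      regroup : ∀ a p s C → a * p * (s * C) ≡ s * a * (p * C)
      regroup = solve-∀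

  h-decreasing : ∀ m₁ m₂ → t ≤ m₁ → m₁ < m₂ → m₂ < k → h m₂ k l t n < h m₁ k l t n
  h-decreasing = steps⇒strictly-decreasing (λ m t≤m 2+m≤k → proj₁ (decrease-step m t≤m 2+m≤k))

  f-decreasing : ∀ m₁ m₂ → t ≤ m₁ → m₁ < m₂ → m₂ < k → f m₂ k l t n < f m₁ k l t n
  f-decreasing = steps⇒strictly-decreasing (λ m t≤m 2+m≤k → proj₂ (decrease-step m t≤m 2+m≤k))

  k≡2+[t+j] : k ≡ 2 + (t + j)
  k≡2+[t+j] = shift t j
    where
    shift : ∀ t j → t + 2 + j ≡ 2 + (t + j)
    shift = solve-∀

  t+j<k : t + j < k
  t+j<k = ≤-trans (n≤1+n _) (≤-reflexive (sym k≡2+[t+j]))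

  -- Two steps of the binomial bound and (t+1)a ≤ c reduce this to c² < 2^x ≤ S(x+2,2).
  f[k]<f[t+j] : f k k l t n < f (t + j) k l t n
  f[k]<f[t+j] = begin-strict
    f k k l t n
      ≡⟨ f-above l t n ≤-refl ⟩
    a ^ (k ∸ t) * (k C t)
      ≡⟨ cong₂ (λ e p → a ^ e * p) k∸t≡2+j (cong (_C t) k≡2+[t+j]) ⟩
    a * (a * aʲ) * ((2 + (t + j)) C t)
      ≤⟨ *-monoʳ-≤ (a * (a * aʲ)) C-bound ⟩
    a * (a * aʲ) * (suc t * (suc t * ((t + j) C t)))
      ≡⟨ regroup a aʲ (suc t) ((t + j) C t) ⟩
    suc t * a * (suc t * a) * (aʲ * ((t + j) C t))
      ≤⟨ *-monoˡ-≤ (aʲ * ((t + j) C t)) (*-mono-≤ [1+t]a≤c [1+t]a≤c) ⟩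
    c * c * (aʲ * ((t + j) C t))
      <⟨ *-monoˡ-< (aʲ * ((t + j) C t)) ⦃ >-nonZero (*-mono-≤ (aᵉ>0 j) (k≤n⇒nCk>0 (m≤m+n t j))) ⦄ c*c<S[x+2,2] ⟩
    S (x + 2) 2 * (aʲ * ((t + j) C t))
      ≡⟨ *-comm (S (x + 2) 2) (aʲ * ((t + j) C t)) ⟩
    aʲ * ((t + j) C t) * S (x + 2) 2
      ≡⟨ cong₂ (λ e q → a ^ e * ((t + j) C t) * q) (m+n∸m≡n t j) S-at-t+j ⟨
    a ^ (t + j ∸ t) * ((t + j) C t) * S (n ∸ (t + j)) (k ∸ (t + j))
      ≡⟨ f-below l t n t+j<k ⟨
    f (t + j) k l t n
      ∎
    where
    aʲ : ℕ
    aʲ = a ^ j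
    C-bound : (2 + (t + j)) C t ≤ suc t * (suc t * ((t + j) C t))
    C-bound = begin
      (2 + (t + j)) C t                ≤⟨ k≤n⇒[1+n]Ck≤[1+k]*nCk (≤-trans (m≤m+n t j) (n≤1+n _)) ⟩
      suc t * ((1 + (t + j)) C t)      ≤⟨ *-monoʳ-≤ (suc t) (k≤n⇒[1+n]Ck≤[1+k]*nCk (m≤m+n t j)) ⟩
      suc t * (suc t * ((t + j) C t))  ∎
    S-at-t+j : S (n ∸ (t + j)) (k ∸ (t + j)) ≡ S (x + 2) 2
    S-at-t+j = cong₂ S (n∸m≡x+d (t + j) t+j+2≡k) (m+n≡o⇒o∸m≡n (t + j) t+j+2≡k)
      where
      t+j+2≡k : t + j + 2 ≡ k
      t+j+2≡k = trans (+-comm (t + j) 2) (sym k≡2+[t+j])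
    regroup : ∀ a p s C → a * (a * p) * (s * (s * C)) ≡ s * a * (s * a) * (p * C)
    regroup = solve-∀

  g≤f[u] : ∀ u → t ≤ u → u + 2 ≤ k → ∀ m → u ≤ m → m ≤ k →
    (g m k l t n ≤ f u k l t n) × (g m k l t n ≡ f u k l t n → m ≡ u)
  g≤f[u] u t≤u u+2≤k = F[m]⊔F[k]≤F[u] (λ m₁ m₂ u≤m₁ → f-decreasing m₁ m₂ (≤-trans t≤u u≤m₁))
    (<-≤-trans f[k]<f[t+j] (steps⇒decreasing (λ m t≤m 2+m≤k → proj₂ (decrease-step m t≤m 2+m≤k))
      u (t + j) t≤u u≤t+j t+j<k))
    where
    u≤t+j : u ≤ t + j
    u≤t+j = +-cancelʳ-≤ 2 u (t + j) (≤-trans u+2≤k (≤-reflexive (shift t j)))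
      where
      shift : ∀ t j → t + 2 + j ≡ t + j + 2
      shift = solve-∀

  f[t]≡S[n∸t,k∸t] : f t k l t n ≡ S (n ∸ t) (k ∸ t)
  f[t]≡S[n∸t,k∸t] = begin-equality
    f t k l t n                                ≡⟨ f-below l t n (≤-trans (m<m+n t (s≤s z≤n)) (m≤m+n (t + 2) j)) ⟩
    a ^ (t ∸ t) * (t C t) * S (n ∸ t) (k ∸ t)  ≡⟨ cong₂ (λ e p → a ^ e * p * S (n ∸ t) (k ∸ t)) (n∸n≡0 t) (nCn≡1 t) ⟩
    1 * 1 * S (n ∸ t) (k ∸ t)                  ≡⟨ *-identityˡ (S (n ∸ t) (k ∸ t)) ⟩
    S (n ∸ t) (k ∸ t)                          ∎

  g≤S[n∸t,k∸t] : ∀ m → t ≤ m → m ≤ k →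
    (g m k l t n ≤ S (n ∸ t) (k ∸ t)) × (g m k l t n ≡ S (n ∸ t) (k ∸ t) → m ≡ t)
  g≤S[n∸t,k∸t] m t≤m m≤k = subst (λ s → (g m k l t n ≤ s) × (g m k l t n ≡ s → m ≡ t)) f[t]≡S[n∸t,k∸t]
    (g≤f[u] t ≤-refl (m≤m+n (t + 2) j) m t≤m m≤k)

lemma5p4 : (t k l n : ℕ) → 1 ≤ t → t + 2 ≤ k → t ≤ l → LBound (k ⊔ l) t n →
    ((m₁ m₂ : ℕ) → t ≤ m₁ → m₁ < m₂ → m₂ ≤ k ∸ 1 →
        (h m₂ k l t n < h m₁ k l t n) × (f m₂ k l t n < f m₁ k l t n))
    × ((u : ℕ) → t ≤ u → u + 2 ≤ k → (m : ℕ) → u ≤ m → m ≤ k →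
        (g m k l t n ≤ f u k l t n) × (g m k l t n ≡ f u k l t n → m ≡ u))
    × ((m : ℕ) → t ≤ m → m ≤ k →
        (g m k l t n ≤ S (n ∸ t) (k ∸ t)) × (g m k l t n ≡ S (n ∸ t) (k ∸ t) → m ≡ t))
-- Matching t = suc _ makes k ∸ 1 reduce, so s≤s turns m₂ ≤ k ∸ 1 into m₂ < k.
lemma5p4 t@(suc _) k l n 1≤t t+2≤k _ LB with m≤n⇒∃[o]m+o≡n t+2≤k
... | j , refl = part-i , g≤f[u] , g≤S[n∸t,k∸t]
  where
  open Setting t j l n 1≤t LB using (h-decreasing; f-decreasing; g≤f[u]; g≤S[n∸t,k∸t])
  part-i : ∀ m₁ m₂ → t ≤ m₁ → m₁ < m₂ → m₂ ≤ k ∸ 1 →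
    (h m₂ k l t n < h m₁ k l t n) × (f m₂ k l t n < f m₁ k l t n)
  part-i m₁ m₂ t≤m₁ m₁<m₂ m₂≤k∸1 =
    h-decreasing m₁ m₂ t≤m₁ m₁<m₂ (s≤s m₂≤k∸1) , f-decreasing m₁ m₂ t≤m₁ m₁<m₂ (s≤s m₂≤k∸1)
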